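{- Let $G$ be a graph and $k,m\ge1$. Then $k$ cops have a winning strategy against $m$ robbers on $G$ if and only if $k$ cops have a winning strategy against a single robber on $G$.
   Context: All graphs are finite, simple apart from loops, connected and reflexive. The game of $k$ cops and $m$ robbers: in round $0$ the cops choose starting vertices, then the robbers choose starting vertices (players may share vertices). In each round $i\ge1$ every cop moves to an adjacent vertex or stays, then every robber moves to an adjacent vertex or stays. Whenever a cop occupies the same vertex as some robbers, those robbers are captured and leave the game. The cops win if all robbers are captured in finitely many rounds; the robbers win if at least one robber evades capture forever. -}

module Defs where

open import Data.Nat using (ℕ; zero; suc; _≤_)
open import Data.Fin using (Fin)
open import Data.Fin.Properties using (_≟_)
open import Data.Unit using (⊤)
open import Data.Bool using (Bool; true; false; if_then_else_)
open import Data.Maybe using (Maybe; just; nothing)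
open import Data.Vec using (Vec; []; _∷_; map; zipWith)
open import Data.Vec.Relation.Unary.All using (All)
open import Data.Vec.Relation.Binary.Pointwise.Inductive using (Pointwise)
open import Data.List using (List; []; _∷_)
open import Data.Product using (Σ; _×_; _,_; proj₁; proj₂; ∃-syntax)
open import Relation.Nullary using (does)
open import Relation.Binary.PropositionalEquality using (_≡_)
open import Relation.Binary.Construct.Closure.ReflexiveTransitive using (Star)

record Graph : Set₁ where
  field
    n         : ℕ
    Adj       : Fin n → Fin n → Set
    nonempty  : 1 ≤ n
    adj-refl  : ∀ v → Adj v v
    adj-sym   : ∀ {u v} → Adj u v → Adj v u
    connected : ∀ u v → Star Adj u v

open Graph public

-- Game positions.
-- Cops' positions: Vec (Fin n) k.
-- Robbers: Vec (Maybe (Fin n)) m, where 'nothing' = captured (left game).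

V : Graph → Set
V G = Fin (n G)

State : Graph → ℕ → ℕ → Set
State G k m = Vec (V G) k × Vec (Maybe (V G)) m

occupied : ∀ {n k} → Vec (Fin n) k → Fin n → Bool
occupied []       v = false
occupied (c ∷ cs) v = if does (c ≟ v) then true else occupied cs v

capture : ∀ {n k} → Vec (Fin n) k → Fin n → Maybe (Fin n)
capture cs v = if occupied cs v then nothing else just v

robberUpdate : ∀ {n k} → Vec (Fin n) k → Maybe (Fin n) → Fin n → Maybe (Fin n)
robberUpdate cs' nothing  q = nothing
robberUpdate cs' (just p) q = if occupied cs' p then nothing else capture cs' q

CopMoveLegal : ∀ (G : Graph) {k} → Vec (V G) k → Vec (V G) k → Set
CopMoveLegal G cs cs' = Pointwise (Adj G) cs cs'

RobberLegal1 : ∀ (G : Graph) → Maybe (V G) → V G → Set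
RobberLegal1 G nothing  q = ⊤
RobberLegal1 G (just p) q = Adj G p q

RobberMoveLegal : ∀ (G : Graph) {m} → Vec (Maybe (V G)) m → Vec (V G) m → Set
RobberMoveLegal G rs rs' = Pointwise (RobberLegal1 G) rs rs'

-- Strategies (perfect information, full history).
-- A history is the current state together with the list of earlier
-- states (most recent first).

record CopStrategy (G : Graph) (k m : ℕ) : Set where
  field
    start : Vec (V G) k
    step  : State G k m → List (State G k m) → Vec (V G) k
    legal : ∀ s hs → CopMoveLegal G (proj₁ s) (step s hs)

record RobberStrategy (G : Graph) (k m : ℕ) : Set where
  field
    start : Vec (V G) k → Vec (V G) m
    step  : State G k m → List (State G k m) → Vec (V G) k → Vec (V G) m
    legal : ∀ s hs cs' → RobberMoveLegal G (proj₂ s) (step s hs cs')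

play : ∀ {G : Graph} {k m} → CopStrategy G k m → RobberStrategy G k m → ℕ
     → State G k m × List (State G k m)
play {G} σ ρ zero =
  let cs = CopStrategy.start σ
      rs = RobberStrategy.start ρ cs
  in (cs , map (capture cs) rs) , []
play {G} σ ρ (suc t) with play σ ρ t
... | s , hs =
  let cs' = CopStrategy.step σ s hs
      rs' = RobberStrategy.step ρ s hs cs'
  in (cs' , zipWith (robberUpdate cs') (proj₂ s) rs') , (s ∷ hs)

stateAt : ∀ {G : Graph} {k m} → CopStrategy G k m → RobberStrategy G k m → ℕ → State G k m
stateAt σ ρ t = proj₁ (play σ ρ t)

AllCaptured : ∀ {G : Graph} {k m} → State G k m → Set
AllCaptured (cs , rs) = All (λ r → r ≡ nothing) rs

CopsWin : Graph → ℕ → ℕ → Set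
CopsWin G k m = Σ (CopStrategy G k m) λ σ →
  (ρ : RobberStrategy G k m) → ∃[ t ] AllCaptured {G} (stateAt σ ρ t)

{-# OPTIONS --safe #-}
module Submission where

-- If k cops beat m robbers, they beat one robber by pretending it is m robbers standing together:
-- the copies move identically and are captured together.
-- Conversely, let σ beat one robber from its start position. Against m robbers the cops walk to
-- that position (tuples of cop positions are connected because G is), pick a robber still in the
-- game and play σ against it alone. Its moves, replayed round by round, form a single-robber
-- strategy, which σ beats; so the chased robber is caught after finitely many rounds, and the cops
-- walk back. Each such phase removes a robber, so all are caught after at most m phases.

open import Defs
open import Data.Nat using (ℕ; zero; suc; _+_; _≤_; _<_; z≤n; s≤s)
open import Data.Nat.Properties using (≤-refl; ≤-trans; <-≤-trans; ≤-pred; m≤n⇒m≤1+n)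
open import Data.Fin using (Fin; zero; suc)
open import Data.Fin.Properties using (_≟_)
open import Data.Bool using (false)
open import Data.Maybe using (Maybe; just; nothing)
import Data.Maybe.Properties as Maybe
open import Data.Vec using (Vec; []; _∷_; lookup; replicate; zipWith)
import Data.Vec as Vec
import Data.Vec.Properties as Vec
open import Data.Vec.Relation.Unary.All as All using (All; []; _∷_)
open import Data.Vec.Relation.Binary.Pointwise.Inductive as Pointwise using (Pointwise; []; _∷_)
open import Data.List using (List; []; _∷_; length)
import Data.List as List
import Data.List.Properties as List
open import Data.Product using (Σ; ∃-syntax; ∃₂; _×_; _,_; proj₁; proj₂)
open import Data.Sum using (_⊎_; inj₁; inj₂)
open import Data.Unit using (tt)
open import Function using (_∘_; id)
open import Function.Bundles using (_⇔_; mk⇔)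
open import Relation.Nullary using (yes; no; contradiction)
open import Relation.Binary.PropositionalEquality
open import Relation.Binary.Construct.Closure.ReflexiveTransitive using (Star; ε; _◅_; _◅◅_; gmap)

capture-just : ∀ {n k} (cs : Vec (Fin n) k) {v p} → capture cs v ≡ just p → capture cs p ≡ just p
capture-just cs {v} e with occupied cs v in free
capture-just cs refl | false rewrite free = refl

robberUpdate-just : ∀ {n k} (cs : Vec (Fin n) k) r q {p} →
  robberUpdate cs r q ≡ just p → capture cs p ≡ just p
robberUpdate-just cs (just p₀) q e with occupied cs p₀
... | false = capture-just cs e

StaysCaptured : ∀ {A : Set} → Maybe A → Maybe A → Set
StaysCaptured r r′ = r ≡ nothing → r′ ≡ nothing

zipWith-robberUpdate-staysCaptured : ∀ {n k j} (cs : Vec (Fin n) k) (rs : Vec (Maybe (Fin n)) j) qs →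
  Pointwise StaysCaptured rs (zipWith (robberUpdate cs) rs qs)
zipWith-robberUpdate-staysCaptured cs []       []       = []
zipWith-robberUpdate-staysCaptured cs (r ∷ rs) (q ∷ qs) =
  (λ { refl → refl }) ∷ zipWith-robberUpdate-staysCaptured cs rs qs

module _ {A : Set} where

  #alive : ∀ {n} → Vec (Maybe A) n → ℕ
  #alive []             = 0
  #alive (nothing ∷ rs) = #alive rs
  #alive (just _ ∷ rs)  = suc (#alive rs)

  #alive-mono : ∀ {n} {rs rs′ : Vec (Maybe A) n} →
    Pointwise StaysCaptured rs rs′ → #alive rs′ ≤ #alive rs
  #alive-mono [] = z≤n
  #alive-mono {rs = nothing ∷ _} {nothing ∷ _} (_ ∷ rest) = #alive-mono rest
  #alive-mono {rs = nothing ∷ _} {just _ ∷ _}  (stays ∷ _) with () ← stays refl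
  #alive-mono {rs = just _ ∷ _}  {nothing ∷ _} (_ ∷ rest) = m≤n⇒m≤1+n (#alive-mono rest)
  #alive-mono {rs = just _ ∷ _}  {just _ ∷ _}  (_ ∷ rest) = s≤s (#alive-mono rest)

  #alive-strict : ∀ {n} {rs rs′ : Vec (Maybe A) n} → Pointwise StaysCaptured rs rs′ →
    ∀ i {p} → lookup rs i ≡ just p → lookup rs′ i ≡ nothing → #alive rs′ < #alive rs
  #alive-strict {rs = just _ ∷ _} {nothing ∷ _} (_ ∷ rest) zero refl refl = s≤s (#alive-mono rest)
  #alive-strict {rs = nothing ∷ _} {nothing ∷ _} (_ ∷ rest) (suc i) alive caught =
    #alive-strict rest i alive caught
  #alive-strict {rs = nothing ∷ _} {just _ ∷ _} (stays ∷ _) (suc i) _ _ with () ← stays refl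
  #alive-strict {rs = just _ ∷ _} {nothing ∷ _} (_ ∷ rest) (suc i) alive caught =
    m≤n⇒m≤1+n (#alive-strict rest i alive caught)
  #alive-strict {rs = just _ ∷ _} {just _ ∷ _} (_ ∷ rest) (suc i) alive caught =
    s≤s (#alive-strict rest i alive caught)

  #alive-zero : ∀ {n} (rs : Vec (Maybe A) n) → #alive rs ≤ 0 → All (_≡ nothing) rs
  #alive-zero []             _    = []
  #alive-zero (nothing ∷ rs) none = refl ∷ #alive-zero rs none

  firstAlive : ∀ {n} (rs : Vec (Maybe A) n) → All (_≡ nothing) rs ⊎ ∃₂ λ i p → lookup rs i ≡ just p
  firstAlive []             = inj₁ []
  firstAlive (just p ∷ rs)  = inj₂ (zero , p , refl)
  firstAlive (nothing ∷ rs) with firstAlive rs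
  ... | inj₁ none            = inj₁ (refl ∷ none)
  ... | inj₂ (i , p , alive) = inj₂ (suc i , p , alive)

module Game (G : Graph) where

  private variable k m : ℕ

  stayPut : (cs : Vec (V G) k) → CopMoveLegal G cs cs
  stayPut cs = Pointwise.refl (λ {v} → adj-refl G v)

  copsConnected : (a b : Vec (V G) k) → Star (CopMoveLegal G) a b
  copsConnected []       []       = ε
  copsConnected (x ∷ xs) (y ∷ ys) =
    gmap (_∷ xs) (_∷ stayPut xs) (connected G x y) ◅◅
    gmap (y ∷_) (adj-refl G y ∷_) (copsConnected xs ys)

  -- Strategies must be legal from every position, reachable or not: stepAlong makes a planned
  -- move a → b only from a, and follow copies a robber's move r₀ → q only from r₀.
  stepAlong : ∀ {a b : Vec (V G) k} → CopMoveLegal G a b → Vec (V G) k → Vec (V G) k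
  stepAlong {a = a} {b} _ cs with Vec.≡-dec _≟_ cs a
  ... | yes _ = b
  ... | no _  = cs

  stepAlong-legal : ∀ {a b : Vec (V G) k} (ab : CopMoveLegal G a b) cs → CopMoveLegal G cs (stepAlong ab cs)
  stepAlong-legal {a = a} ab cs with Vec.≡-dec _≟_ cs a
  ... | yes refl = ab
  ... | no _     = stayPut cs

  stepAlong-from : ∀ {a b : Vec (V G) k} (ab : CopMoveLegal G a b) → stepAlong ab a ≡ b
  stepAlong-from {a = a} ab with Vec.≡-dec _≟_ a a
  ... | yes _  = refl
  ... | no a≢a = contradiction refl a≢a

  follow : Maybe (V G) → V G → Maybe (V G) → V G
  follow r₀ q r with Maybe.≡-dec _≟_ r r₀
  follow r₀ q r        | yes _ = q
  follow r₀ q nothing  | no _  = q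
  follow r₀ q (just p) | no _  = p

  follow-legal : ∀ {r₀ q} → RobberLegal1 G r₀ q → ∀ r → RobberLegal1 G r (follow r₀ q r)
  follow-legal {r₀} {q} legal r with Maybe.≡-dec _≟_ r r₀
  follow-legal legal r        | yes refl = legal
  follow-legal legal nothing  | no _     = tt
  follow-legal legal (just p) | no _     = adj-refl G p

  follow-self : ∀ r q → follow r q r ≡ q
  follow-self r q with Maybe.≡-dec _≟_ r r
  ... | yes _  = refl
  ... | no r≢r = contradiction refl r≢r

  replay : (from : ℕ → Maybe (V G)) (to : ℕ → V G) → (∀ n → RobberLegal1 G (from n) (to n)) →
    V G → RobberStrategy G k 1
  replay from to legal p = record
    { start = λ _ → p ∷ []
    ; step  = λ { (_ , r ∷ []) h _ → follow (from (length h)) (to (length h)) r ∷ [] }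
    ; legal = λ { (_ , r ∷ []) h _ → follow-legal (legal (length h)) r ∷ [] }
    }

  replay-step : ∀ from to legal p {n} (cs : Vec (V G) k) h cs′ → length h ≡ n →
    RobberStrategy.step (replay from to legal p) (cs , from n ∷ []) h cs′ ≡ to n ∷ []
  replay-step from to _ _ {n} _ _ _ refl = cong (_∷ []) (follow-self (from n) (to n))

  round : CopStrategy G k m → RobberStrategy G k m → State G k m → List (State G k m) → State G k m
  round σ ρ s hs = cs′ , zipWith (robberUpdate cs′) (proj₂ s) (RobberStrategy.step ρ s hs cs′)
    where cs′ = CopStrategy.step σ s hs

  project : Fin m → State G k m → State G k 1
  project i (cs , rs) = cs , lookup rs i ∷ []

  round-project : ∀ (σ : CopStrategy G k m) (ρ : RobberStrategy G k m)
    (σ₁ : CopStrategy G k 1) (ρ₁ : RobberStrategy G k 1) s hs h i →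
    CopStrategy.step σ₁ (project i s) h ≡ CopStrategy.step σ s hs →
    RobberStrategy.step ρ₁ (project i s) h (CopStrategy.step σ s hs)
      ≡ lookup (RobberStrategy.step ρ s hs (CopStrategy.step σ s hs)) i ∷ [] →
    round σ₁ ρ₁ (project i s) h ≡ project i (round σ ρ s hs)
  round-project σ ρ σ₁ ρ₁ s hs h i sameCops sameMove
    rewrite sameCops | sameMove =
      cong (λ r → CopStrategy.step σ s hs , r ∷ [])
           (sym (Vec.lookup-zipWith (robberUpdate (CopStrategy.step σ s hs)) i (proj₂ s) _))

  module Play (σ : CopStrategy G k m) (ρ : RobberStrategy G k m) where

    S : ℕ → State G k m
    S = stateAt σ ρ

    history : ℕ → List (State G k m)
    history t = proj₂ (play σ ρ t)

    cops : ℕ → Vec (V G) k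
    cops t = proj₁ (S t)

    robbers : ℕ → Vec (Maybe (V G)) m
    robbers t = proj₂ (S t)

    length-history : ∀ t → length (history t) ≡ t
    length-history zero    = refl
    length-history (suc t) = cong suc (length-history t)

    staysCaptured : ∀ t → Pointwise StaysCaptured (robbers t) (robbers (suc t))
    staysCaptured t = zipWith-robberUpdate-staysCaptured (cops (suc t)) (robbers t) _

    #alive-step : ∀ t → #alive (robbers (suc t)) ≤ #alive (robbers t)
    #alive-step t = #alive-mono (staysCaptured t)

    #alive-antitone : ∀ d t → #alive (robbers (d + t)) ≤ #alive (robbers t)
    #alive-antitone zero    t = ≤-refl
    #alive-antitone (suc d) t = ≤-trans (#alive-step (d + t)) (#alive-antitone d t)

    alive⇒capture-just : ∀ t i {p} → lookup (robbers t) i ≡ just p → capture (cops t) p ≡ just p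
    alive⇒capture-just zero i alive =
      capture-just (cops 0)
        (trans (sym (Vec.lookup-map i (capture (cops 0)) (RobberStrategy.start ρ (cops 0)))) alive)
    alive⇒capture-just (suc t) i alive =
      robberUpdate-just (cops (suc t)) (lookup (robbers t) i) (lookup moves i)
        (trans (sym (Vec.lookup-zipWith (robberUpdate (cops (suc t))) i (robbers t) moves)) alive)
      where moves = RobberStrategy.step ρ (S t) (history t) (cops (suc t))

module ToOneRobber {G : Graph} {k m : ℕ} (σ : CopStrategy G k (suc m)) where

  open Game G

  clone : State G k 1 → State G k (suc m)
  clone (cs , rs) = cs , replicate (suc m) (lookup rs zero)

  project-clone : ∀ s → project zero (clone s) ≡ s
  project-clone (cs , r ∷ []) = refl

  map-project-clone : ∀ hs → List.map (project zero) (List.map clone hs) ≡ hs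
  map-project-clone hs = begin
    List.map (project zero) (List.map clone hs) ≡⟨ List.map-∘ hs ⟨
    List.map (project zero ∘ clone) hs          ≡⟨ List.map-cong project-clone hs ⟩
    List.map id hs                              ≡⟨ List.map-id hs ⟩
    hs                                          ∎
    where open ≡-Reasoning

  oneRobber : CopStrategy G k 1
  oneRobber = record
    { start = CopStrategy.start σ
    ; step  = λ s hs → CopStrategy.step σ (clone s) (List.map clone hs)
    ; legal = λ s hs → CopStrategy.legal σ (clone s) (List.map clone hs)
    }

  followAll-legal : ∀ {j r₀ q} → RobberLegal1 G r₀ q → (rs : Vec (Maybe (V G)) j) →
    RobberMoveLegal G rs (Vec.map (follow r₀ q) rs)
  followAll-legal legal []       = []
  followAll-legal legal (r ∷ rs) = follow-legal legal r ∷ followAll-legal legal rs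

  module _ (ρ : RobberStrategy G k 1) where

    oneMove : State G k (suc m) → List (State G k (suc m)) → Vec (V G) k → V G
    oneMove s hs cs′ = lookup (RobberStrategy.step ρ (project zero s) (List.map (project zero) hs) cs′) zero

    cloneRobber : RobberStrategy G k (suc m)
    cloneRobber = record
      { start = λ cs → replicate (suc m) (lookup (RobberStrategy.start ρ cs) zero)
      ; step  = λ s hs cs′ → Vec.map (follow (lookup (proj₂ s) zero) (oneMove s hs cs′)) (proj₂ s)
      ; legal = λ s hs cs′ → followAll-legal
          (Pointwise.lookup (RobberStrategy.legal ρ (project zero s) (List.map (project zero) hs) cs′) zero)
          (proj₂ s)
      }

    round-clone : ∀ s hs →
      round σ cloneRobber (clone s) (List.map clone hs) ≡ clone (round oneRobber ρ s hs)
    round-clone s hs = cong (cs′ ,_) (begin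
      zipWith (robberUpdate cs′) (replicate (suc m) r) (Vec.map (follow r q) (replicate (suc m) r))
        ≡⟨ cong (zipWith (robberUpdate cs′) (replicate (suc m) r))
                (Vec.map-replicate (follow r q) r (suc m)) ⟩
      zipWith (robberUpdate cs′) (replicate (suc m) r) (replicate (suc m) (follow r q r))
        ≡⟨ Vec.zipWith-replicate (robberUpdate cs′) r (follow r q r) ⟩
      replicate (suc m) (robberUpdate cs′ r (follow r q r))
        ≡⟨ cong (replicate (suc m) ∘ robberUpdate cs′ r) (trans (follow-self r q) sameMove) ⟩
      replicate (suc m) (robberUpdate cs′ r (lookup moves zero))
        ≡⟨ cong (replicate (suc m)) (Vec.lookup-zipWith (robberUpdate cs′) zero (proj₂ s) moves) ⟨
      replicate (suc m) (lookup (zipWith (robberUpdate cs′) (proj₂ s) moves) zero) ∎)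
      where
      open ≡-Reasoning
      cs′ = CopStrategy.step oneRobber s hs
      r = lookup (proj₂ s) zero
      q = oneMove (clone s) (List.map clone hs) cs′
      moves = RobberStrategy.step ρ s hs cs′
      sameMove : q ≡ lookup moves zero
      sameMove = cong₂ (λ s₁ h → lookup (RobberStrategy.step ρ s₁ h cs′) zero)
                       (project-clone s) (map-project-clone hs)

    open Play oneRobber ρ

    play-clone : ∀ t → play σ cloneRobber t ≡ (clone (S t) , List.map clone (history t))
    play-clone zero = cong (λ rs → (cs , rs) , []) (begin
      Vec.map (capture cs) (replicate (suc m) (lookup r₀ zero))
        ≡⟨ Vec.map-replicate (capture cs) (lookup r₀ zero) (suc m) ⟩
      replicate (suc m) (capture cs (lookup r₀ zero))
        ≡⟨ cong (replicate (suc m)) (Vec.lookup-map zero (capture cs) r₀) ⟨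
      replicate (suc m) (lookup (Vec.map (capture cs) r₀) zero) ∎)
      where
      open ≡-Reasoning
      cs = CopStrategy.start σ
      r₀ = RobberStrategy.start ρ cs
    play-clone (suc t) = begin
      play σ cloneRobber (suc t)
        ≡⟨ cong next (play-clone t) ⟩
      (round σ cloneRobber (clone (S t)) (List.map clone (history t)) , clone (S t) ∷ List.map clone (history t))
        ≡⟨ cong (_, clone (S t) ∷ List.map clone (history t)) (round-clone (S t) (history t)) ⟩
      (clone (S (suc t)) , List.map clone (history (suc t))) ∎
      where
      open ≡-Reasoning
      next : State G k (suc m) × List (State G k (suc m)) → State G k (suc m) × List (State G k (suc m))
      next (s , hs) = round σ cloneRobber s hs , s ∷ hs

  allCaptured-clone : ∀ s → AllCaptured {G} (clone s) → AllCaptured {G} s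
  allCaptured-clone (cs , r ∷ []) (caught ∷ _) = caught ∷ []

  toOneRobber : (∀ ρ → ∃[ t ] AllCaptured {G} (stateAt σ ρ t)) → CopsWin G k 1
  toOneRobber win = oneRobber , λ ρ →
    let t , caught = win (cloneRobber ρ)
    in t , allCaptured-clone (stateAt oneRobber ρ t)
                             (subst (AllCaptured {G} ∘ proj₁) (play-clone ρ t) caught)

module FromOneRobber {G : Graph} {k m : ℕ} (σ : CopStrategy G k 1) where

  open Game G

  home : Vec (V G) k
  home = CopStrategy.start σ

  HomeWalk : Vec (V G) k → Set
  HomeWalk a = Star (CopMoveLegal G) a home

  data Memory : Set where
    walk  : ∀ {a} → HomeWalk a → Memory
    chase : Fin m → List (State G k 1) → Memory

  chaseFirstAlive : {rs : Vec (Maybe (V G)) m} →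
    All (_≡ nothing) rs ⊎ ∃₂ (λ i p → lookup rs i ≡ just p) → Memory
  chaseFirstAlive (inj₁ _)       = walk ε
  chaseFirstAlive (inj₂ (i , _)) = chase i []

  arrive : ∀ {a} → HomeWalk a → State G k m → Memory
  arrive ε           s = chaseFirstAlive (firstAlive (proj₂ s))
  arrive P@(_ ◅ _) _ = walk P

  goHome : State G k m → Memory
  goHome s = arrive (copsConnected (proj₁ s) home) s

  move : Memory → State G k m → Vec (V G) k
  move (walk ε)        s = proj₁ s
  move (walk (ab ◅ _)) s = stepAlong ab (proj₁ s)
  move (chase i h)     s = CopStrategy.step σ (project i s) h

  move-legal : ∀ M s → CopMoveLegal G (proj₁ s) (move M s)
  move-legal (walk ε)        s = stayPut (proj₁ s)
  move-legal (walk (ab ◅ _)) s = stepAlong-legal ab (proj₁ s)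
  move-legal (chase i h)     s = CopStrategy.legal σ (project i s) h

  continueChase : Fin m → List (State G k 1) → State G k m → Maybe (V G) → Memory
  continueChase i h _  (just _) = chase i h
  continueChase i h s′ nothing  = goHome s′

  update : Memory → State G k m → State G k m → Memory
  update (walk ε)       _ s′ = arrive ε s′
  update (walk (_ ◅ P)) _ s′ = arrive P s′
  update (chase i h)    s s′ = continueChase i (project i s ∷ h) s′ (lookup (proj₂ s′) i)

  memory : State G k m → List (State G k m) → Memory
  memory s []        = goHome s
  memory s (s′ ∷ hs) = update (memory s′ hs) s′ s

  strategy : CopStrategy G k m
  strategy = record
    { start = home
    ; step  = λ s hs → move (memory s hs) s
    ; legal = λ s hs → move-legal (memory s hs) s
    }

  arrive-home : ∀ s → AllCaptured {G} s ⊎ ∃₂ λ i p → lookup (proj₂ s) i ≡ just p × arrive ε s ≡ chase i []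
  arrive-home s with firstAlive (proj₂ s)
  ... | inj₁ none            = inj₁ none
  ... | inj₂ (i , p , alive) = inj₂ (i , p , alive , refl)

  module Against (win : ∀ ρ → ∃[ t ] AllCaptured {G} (stateAt σ ρ t)) (ρ : RobberStrategy G k m) where

    open Play strategy ρ

    memoryAt : ℕ → Memory
    memoryAt t = memory (S t) (history t)

    HeadingHome : ℕ → Set
    HeadingHome t = ∃[ a ] Σ (HomeWalk a) λ P → cops t ≡ a × memoryAt t ≡ arrive P (S t)

    ChaseStart : ℕ → Set
    ChaseStart t = ∃₂ λ i p → memoryAt t ≡ chase i [] × cops t ≡ home × lookup (robbers t) i ≡ just p

    walk-home : ∀ t {a} (P : HomeWalk a) → cops t ≡ a → memoryAt t ≡ arrive P (S t) →
      ∃[ t′ ] #alive (robbers t′) ≤ #alive (robbers t) × (AllCaptured {G} (S t′) ⊎ ChaseStart t′)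
    walk-home t ε atHome arrived with arrive-home (S t)
    ... | inj₁ none                      = t , ≤-refl , inj₁ none
    ... | inj₂ (i , p , alive , chasing) = t , ≤-refl , inj₂ (i , p , trans arrived chasing , atHome , alive)
    walk-home t (ab ◅ P) atA arrived =
      let t′ , fewer , done = walk-home (suc t) P atB stillWalking
      in t′ , ≤-trans fewer (#alive-step t) , done
      where
      atB : cops (suc t) ≡ _
      atB = trans (cong (λ M → move M (S t)) arrived) (trans (cong (stepAlong ab) atA) (stepAlong-from ab))
      stillWalking : memoryAt (suc t) ≡ arrive P (S (suc t))
      stillWalking = cong (λ M → update M (S t) (S (suc t))) arrived

    module Chase {T i p} (chasing : memoryAt T ≡ chase i []) (atHome : cops T ≡ home)
                 (alive : lookup (robbers T) i ≡ just p) where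

      target : ℕ → Maybe (V G)
      target j = lookup (robbers (j + T)) i

      targetMove : ℕ → V G
      targetMove j = lookup (RobberStrategy.step ρ (S (j + T)) (history (j + T)) (cops (suc j + T))) i

      targetMove-legal : ∀ j → RobberLegal1 G (target j) (targetMove j)
      targetMove-legal j =
        Pointwise.lookup (RobberStrategy.legal ρ (S (j + T)) (history (j + T)) (cops (suc j + T))) i

      ρ₁ : RobberStrategy G k 1
      ρ₁ = replay target targetMove targetMove-legal p

      module Single = Play σ ρ₁

      Mirrors : ℕ → Set
      Mirrors j = Single.S j ≡ project i (S (j + T))
                × memoryAt (j + T) ≡ chase i (Single.history j)
                × ∃[ p′ ] target j ≡ just p′

      Progress : Set
      Progress = ∃[ t ] #alive (robbers t) < #alive (robbers T) × HeadingHome t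

      mirrors-zero : Mirrors 0
      mirrors-zero = cong₂ _,_ (sym atHome) (cong (_∷ []) (trans unguarded (sym alive))) , chasing , p , alive
        where
        unguarded : capture home p ≡ just p
        unguarded = subst (λ cs → capture cs p ≡ just p) atHome (alive⇒capture-just T i alive)

      round-mirrors : ∀ j → Mirrors j → Single.S (suc j) ≡ project i (S (suc j + T))
      round-mirrors j (same , chasing′ , _) = begin
        round σ ρ₁ (Single.S j) (Single.history j)
          ≡⟨ cong (λ s → round σ ρ₁ s (Single.history j)) same ⟩
        round σ ρ₁ (project i (S (j + T))) (Single.history j)
          ≡⟨ round-project strategy ρ σ ρ₁ (S (j + T)) (history (j + T)) (Single.history j) i
                           sameCops sameMove ⟩
        project i (S (suc j + T)) ∎
        where
        open ≡-Reasoning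
        sameCops : CopStrategy.step σ (project i (S (j + T))) (Single.history j) ≡ cops (suc j + T)
        sameCops = sym (cong (λ M → move M (S (j + T))) chasing′)
        sameMove : RobberStrategy.step ρ₁ (project i (S (j + T))) (Single.history j) (cops (suc j + T))
                 ≡ targetMove j ∷ []
        sameMove = replay-step target targetMove targetMove-legal p
                     (cops (j + T)) (Single.history j) (cops (suc j + T)) (Single.length-history j)

      mirrors-step : ∀ j → Mirrors j → Progress ⊎ Mirrors (suc j)
      mirrors-step j now@(same , chasing′ , _ , alive′) = continue (target (suc j)) refl
        where
        nextMemory : memoryAt (suc j + T) ≡
          continueChase i (project i (S (j + T)) ∷ Single.history j) (S (suc j + T)) (target (suc j))
        nextMemory = cong (λ M → update M (S (j + T)) (S (suc j + T))) chasing′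

        continue : ∀ r → target (suc j) ≡ r → Progress ⊎ Mirrors (suc j)
        continue nothing caught =
          inj₁ (suc j + T , fewer , cops (suc j + T) , copsConnected _ home , refl , goingHome)
          where
          fewer : #alive (robbers (suc j + T)) < #alive (robbers T)
          fewer = <-≤-trans (#alive-strict (staysCaptured (j + T)) i alive′ caught) (#alive-antitone j T)
          goingHome : memoryAt (suc j + T) ≡ goHome (S (suc j + T))
          goingHome = trans nextMemory (cong (continueChase i _ (S (suc j + T))) caught)
        continue (just p″) alive″ = inj₂ (round-mirrors j now , stillChasing , p″ , alive″)
          where
          stillChasing : memoryAt (suc j + T) ≡ chase i (Single.history (suc j))
          stillChasing = trans nextMemory (trans (cong (continueChase i _ (S (suc j + T))) alive″)
                                                 (cong (λ s → chase i (s ∷ Single.history j)) (sym same)))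

      mirrors : ∀ j → Progress ⊎ Mirrors j
      mirrors zero    = inj₂ mirrors-zero
      mirrors (suc j) with mirrors j
      ... | inj₁ progress = inj₁ progress
      ... | inj₂ m        = mirrors-step j m

      progress : Progress
      progress with win ρ₁
      ... | j , caught with mirrors j
      ...   | inj₁ progress = progress
      ...   | inj₂ (same , _ , _ , alive′)
              with () ← trans (sym (All.head (subst (AllCaptured {G}) same caught))) alive′

    captures-all-from : ∀ N t → #alive (robbers t) ≤ N → HeadingHome t → ∃[ t′ ] AllCaptured {G} (S t′)
    captures-all-from zero    t none _ = t , #alive-zero (robbers t) none
    captures-all-from (suc N) t bound (_ , P , atA , arrived) with walk-home t P atA arrived
    ... | t₁ , _ , inj₁ done = t₁ , done
    ... | t₁ , fewer₁ , inj₂ (_ , _ , chasing , atHome , alive) =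
      let t₂ , fewer₂ , heading = Chase.progress {T = t₁} chasing atHome alive
      in captures-all-from N t₂ (≤-pred (≤-trans fewer₂ (≤-trans fewer₁ bound))) heading

    captures-all : ∃[ t ] AllCaptured {G} (S t)
    captures-all =
      captures-all-from (#alive (robbers 0)) 0 ≤-refl (cops 0 , copsConnected (cops 0) home , refl , refl)

  fromOneRobber : (∀ ρ → ∃[ t ] AllCaptured {G} (stateAt σ ρ t)) → CopsWin G k m
  fromOneRobber win = strategy , Against.captures-all win

-- The reduction works for any number of cops.
lemma2p1 : (G : Graph) (k m : ℕ) → 1 ≤ k → 1 ≤ m → CopsWin G k m ⇔ CopsWin G k 1
lemma2p1 G k zero    _ ()
lemma2p1 G k (suc m) _ _ = mk⇔ (λ (σ , win) → ToOneRobber.toOneRobber σ win)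
                                  (λ (σ , win) → FromOneRobber.fromOneRobber σ win)
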